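{- For every integer $n\ge 1$, \[ \sum_{p\in\mathcal{D}(n)} q^{\operatorname{area}(p)}t^{\operatorname{rk}(p)} = \sum_{m \in \mathcal{M}(n)} q^{\operatorname{area}(m)}t^{\operatorname{rk}(m)}(1+qt)^{n-1-2\operatorname{rk}(m)}.\]
   Context: A Dyck path of order $n$ is a lattice path from $(0,0)$ to $(2n,0)$ using $n$ up steps $(x,y)\to(x+1,y+1)$ and $n$ down steps $(x,y)\to(x+1,y-1)$ that never goes below the $x$-axis; $\mathcal{D}(n)$ is the set of them. The area $\operatorname{area}(p)$ is the number of points $(x,y)\in\mathbb{Z}^2$ with $x+y$ even and $y\ge0$ lying strictly below $p$ (not on $p$). To $p$ associate the set partition $\phi(p)$ of $\{1,\dots,n\}$ in which $i,i'$ are in the same block iff for some $j$ the points $(2i-1,2j-1)$ and $(2i'-1,2j-1)$ both lie on $p$ and the portion of $p$ between them never goes below $y=2j-1$; set $\operatorname{rk}(p)=n-(\text{number of blocks of }\phi(p))$. A Motzkin path of order $n$ is a path from $(1,1)$ to $(2n-1,1)$ with steps $(2,2)$ (up), $(2,-2)$ (down), $(2,0)$ (horizontal) never going below $y=1$; $\mathcal{M}(n)$ is the set of them (for $n=1$ it is the single empty path). For $m\in\mathcal{M}(n)$ let $\rho(m)\in\mathcal{D}(n)$ be the Dyck path obtained by an initial up step from $(0,0)$ to $(1,1)$, then replacing each up step of $m$ by two up steps, each down step by two down steps, each horizontal step by a down step followed by an up step, and finally a down step to $(2n,0)$. Define $\operatorname{area}(m)=\operatorname{area}(\rho(m))$ and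 $\operatorname{rk}(m)=\operatorname{rk}(\rho(m))$ (which equals the number of up steps of $m$). -}

module Defs where

open import Data.Nat using (ℕ; zero; suc; _+_; _*_; _∸_; _≡ᵇ_; _<ᵇ_; _≤ᵇ_)
open import Data.Bool using (Bool; true; false; _∧_; not)
open import Data.List using (List; []; _∷_; _++_; map; concatMap; length; filterᵇ; upTo; applyUpTo)
open import Data.Bool.ListAction using (all; any)
open import Algebra.Bundles using (CommutativeSemiring)

-- Dyck paths: words in up/down steps.  Step k goes from x = k to x = k+1.

data DStep : Set where
  up down : DStep

words : {A : Set} → List A → ℕ → List (List A)
words as zero    = [] ∷ []
words as (suc k) = concatMap (λ a → map (a ∷_) (words as k)) as

dyckFrom : ℕ → List DStep → Bool
dyckFrom h       []         = h ≡ᵇ 0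
dyckFrom h       (up ∷ s)   = dyckFrom (suc h) s
dyckFrom zero    (down ∷ s) = false
dyckFrom (suc h) (down ∷ s) = dyckFrom h s

-- 𝒟(n): Dyck paths of order n (length 2n, from (0,0) to (2n,0), never below 0);
-- listed without repetition.
dyckPaths : ℕ → List (List DStep)
dyckPaths n = filterᵇ (dyckFrom 0) (words (up ∷ down ∷ []) (2 * n))

heightsFrom : ℕ → List DStep → List ℕ
heightsFrom h []         = h ∷ []
heightsFrom h (up ∷ s)   = h ∷ heightsFrom (suc h) s
heightsFrom h (down ∷ s) = h ∷ heightsFrom (h ∸ 1) s

nth : List ℕ → ℕ → ℕ
nth []       _       = 0
nth (x ∷ xs) zero    = x
nth (x ∷ xs) (suc k) = nth xs k

height : List DStep → ℕ → ℕ
height p x = nth (heightsFrom 0 p) x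

even : ℕ → Bool
even zero          = true
even (suc zero)    = false
even (suc (suc k)) = even k

count : {A : Set} → (A → Bool) → List A → ℕ
count P xs = length (filterᵇ P xs)

sumℕ : {A : Set} → (A → ℕ) → List A → ℕ
sumℕ f []       = 0
sumℕ f (a ∷ as) = f a + sumℕ f as

range : ℕ → ℕ → List ℕ
range a b = applyUpTo (a +_) (suc b ∸ a)

-- area(p): number of lattice points (x,y), x+y even, y ≥ 0, strictly below p,
-- i.e. 0 ≤ x ≤ 2n, 0 ≤ y < height of p at x.
-- (Points with y ≥ 2n+1 or outside 0 ≤ x ≤ 2n are never below p.)
area : List DStep → ℕ
area p = sumℕ (λ x → count (λ y → even (x + y) ∧ (y <ᵇ height p x)) (upTo (suc L))) (upTo (suc L))
  where L = length p

-- the relation of φ(p) between i < i' (i, i' ∈ {1..n}): the points (2i-1, h) and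
-- (2i'-1, h) lie on p at the same (odd) height h = 2j-1 and p does not go below
-- y = h between them.
sameBlock : List DStep → ℕ → ℕ → Bool
sameBlock p i i' =
  (height p (2 * i ∸ 1) ≡ᵇ height p (2 * i' ∸ 1)) ∧
  all (λ x → height p (2 * i ∸ 1) ≤ᵇ height p x) (range (2 * i ∸ 1) (2 * i' ∸ 1))

-- number of blocks of φ(p) for p of order n: the number of i ∈ {1..n} that are the
-- least element of their block (no i' < i lies in the same block).
numBlocks : ℕ → List DStep → ℕ
numBlocks n p = count (λ i → not (any (λ i' → sameBlock p i' i) (range 1 (i ∸ 1)))) (range 1 n)

rk : ℕ → List DStep → ℕ
rk n p = n ∸ numBlocks n p

-- Motzkin paths: words in U/D/H steps, from height 1 (y = 1), never below y = 1.

data MStep : Set where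
  mU mD mH : MStep

-- level h here is the height above y = 1 (in units of 2)
motzFrom : ℕ → List MStep → Bool
motzFrom h       []       = h ≡ᵇ 0
motzFrom h       (mU ∷ s) = motzFrom (suc h) s
motzFrom zero    (mD ∷ s) = false
motzFrom (suc h) (mD ∷ s) = motzFrom h s
motzFrom h       (mH ∷ s) = motzFrom h s

-- ℳ(n): Motzkin paths of order n (n - 1 steps from (1,1) to (2n-1,1)),
-- listed without repetition; ℳ(1) = {empty path}.
motzkinPaths : ℕ → List (List MStep)
motzkinPaths n = filterᵇ (motzFrom 0) (words (mU ∷ mD ∷ mH ∷ []) (n ∸ 1))

ρsteps : MStep → List DStep
ρsteps mU = up ∷ up ∷ []
ρsteps mD = down ∷ down ∷ []
ρsteps mH = down ∷ up ∷ []

ρ : List MStep → List DStep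
ρ m = up ∷ (concatMap ρsteps m ++ down ∷ [])

areaM : List MStep → ℕ
areaM m = area (ρ m)

rkM : ℕ → List MStep → ℕ
rkM n m = rk n (ρ m)

-- Polynomial identities in q, t are stated in an arbitrary commutative semiring
-- (equivalently, in ℕ[q,t], the free commutative semiring on q, t).

module _ {c ℓ} (R : CommutativeSemiring c ℓ) where
  open CommutativeSemiring R using (Carrier; 0#; 1#) renaming (_+_ to _⊕_; _*_ to _⊗_)

  pow : Carrier → ℕ → Carrier
  pow x zero    = 1#
  pow x (suc k) = x ⊗ pow x k

  sumR : {A : Set} → (A → Carrier) → List A → Carrier
  sumR f []       = 0#
  sumR f (a ∷ as) = f a ⊕ sumR f as

-- Cut a Dyck path of order n into its first step, n − 1 pairs of steps starting at odd
-- abscissae, and its last step.  The area is the sum of ⌊h/2⌋ over the heights h of the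
-- path, and the rank is the number of down steps starting at even abscissae: i is the
-- least element of its block of φ(p) exactly when the step arriving at 2i − 1 goes up
-- (after a down step, the last earlier visit to that height is at an odd abscissa).
-- Both statistics are thus products of local weights, and a transfer-matrix recursion on
-- the length shows that, from height 2l + 1, the pairs up–up and down–down weigh as much
-- as Motzkin up and down steps at level l, while up–down and down–up together weigh
-- (1 + qt) times a horizontal step.
module Submission where

open import Defs
open import Algebra.Bundles using (CommutativeSemiring)
open import Data.Bool using (Bool; true; false; not; _∧_; T; T?)
open import Data.Bool.Properties using (T-∧; T-≡; ∧-identityʳ; ∧-zeroʳ; not-involutive)
open import Data.Empty using (⊥-elim)
open import Data.List using (List; []; _∷_; _++_; map; length; filterᵇ; upTo; applyUpTo; concatMap)
open import Data.List.Properties using (filter-++; length-map; length-upTo; map-applyUpTo)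
open import Data.List.Relation.Unary.All as All using (All; []; _∷_)
import Data.List.Relation.Unary.All.Properties as Allₚ
import Data.List.Relation.Unary.Any.Properties as Anyₚ
open import Data.Bool.ListAction using (all; any)
open import Data.Nat using (ℕ; zero; suc; _+_; _*_; _∸_; _≤_; _<_; z≤n; s≤s; _<ᵇ_; ⌊_/2⌋)
import Data.Nat.Properties as ℕₚ
open import Data.Product using (∃-syntax; _×_; _,_)
open import Data.Sum using (inj₁; inj₂)
open import Data.Unit using (tt)
open import Function using (_∘_; id; _⇔_; mk⇔; Equivalence)
open import Relation.Nullary using (¬_; yes; no)
open import Relation.Binary.PropositionalEquality
  using (_≡_; _≢_; refl; sym; trans; cong; cong₂; subst; subst₂; module ≡-Reasoning)

fromBool : Bool → ℕ
fromBool true  = 1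
fromBool false = 0

¬T⇒≡false : ∀ {b} → ¬ T b → b ≡ false
¬T⇒≡false {false} _  = refl
¬T⇒≡false {true}  ¬t = ⊥-elim (¬t tt)

filterᵇ-map : ∀ {A B : Set} (P : B → Bool) (g : A → B) xs →
              filterᵇ P (map g xs) ≡ map g (filterᵇ (P ∘ g) xs)
filterᵇ-map P g []       = refl
filterᵇ-map P g (x ∷ xs) with P (g x)
... | true  = cong (g x ∷_) (filterᵇ-map P g xs)
... | false = filterᵇ-map P g xs

filterᵇ-false : ∀ {A : Set} (xs : List A) → filterᵇ (λ _ → false) xs ≡ []
filterᵇ-false []       = refl
filterᵇ-false (_ ∷ xs) = filterᵇ-false xs

words-length : ∀ {A : Set} (as : List A) k → All (λ w → length w ≡ k) (words as k)
words-length as zero    = refl ∷ []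
words-length as (suc k) =
  Allₚ.concat⁺ (Allₚ.map⁺ (All.universal (λ _ → Allₚ.map⁺ (All.map (cong suc) (words-length as k))) as))

count-∷ : ∀ {A : Set} (P : A → Bool) x xs → count P (x ∷ xs) ≡ fromBool (P x) + count P xs
count-∷ P x xs with P x
... | true  = refl
... | false = refl

count-cong : ∀ {A : Set} {P P′ : A → Bool} {xs} → All (λ x → P x ≡ P′ x) xs → count P xs ≡ count P′ xs
count-cong                      []       = refl
count-cong {P = P} {P′} {x ∷ xs} (e ∷ es) =
  trans (count-∷ P x xs) (trans (cong₂ _+_ (cong fromBool e) (count-cong es)) (sym (count-∷ P′ x xs)))

count-map : ∀ {A B : Set} (P : B → Bool) (g : A → B) xs → count P (map g xs) ≡ count (P ∘ g) xs
count-map P g xs = trans (cong length (filterᵇ-map P g xs)) (length-map g (filterᵇ (P ∘ g) xs))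

count-false : ∀ {A : Set} (xs : List A) → count (λ _ → false) xs ≡ 0
count-false xs = cong length (filterᵇ-false xs)

count-not+count : ∀ {A : Set} (P : A → Bool) xs → count (not ∘ P) xs + count P xs ≡ length xs
count-not+count P []       = refl
count-not+count P (x ∷ xs) with P x
... | true  = trans (ℕₚ.+-suc _ _) (cong suc (count-not+count P xs))
... | false = cong suc (count-not+count P xs)

count-applyUpTo-suc : ∀ (P : ℕ → Bool) n → count P (applyUpTo suc n) ≡ count (P ∘ suc) (upTo n)
count-applyUpTo-suc P n = trans (cong (count P) (sym (map-applyUpTo id suc n))) (count-map P suc (upTo n))

count-upTo-suc : ∀ (P : ℕ → Bool) n → count P (upTo (suc n)) ≡ fromBool (P 0) + count (P ∘ suc) (upTo n)
count-upTo-suc P n = trans (count-∷ P 0 _) (cong (fromBool (P 0) +_) (count-applyUpTo-suc P n))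

sumℕ-cong : ∀ {A : Set} {f g : A → ℕ} {xs} → All (λ x → f x ≡ g x) xs → sumℕ f xs ≡ sumℕ g xs
sumℕ-cong []       = refl
sumℕ-cong (e ∷ es) = cong₂ _+_ e (sumℕ-cong es)

sumℕ-map : ∀ {A B : Set} (f : B → ℕ) (g : A → B) xs → sumℕ f (map g xs) ≡ sumℕ (f ∘ g) xs
sumℕ-map f g []       = refl
sumℕ-map f g (x ∷ xs) = cong (f (g x) +_) (sumℕ-map f g xs)

sumℕ-nth : ∀ (f : ℕ → ℕ) xs → sumℕ (f ∘ nth xs) (upTo (length xs)) ≡ sumℕ f xs
sumℕ-nth f []       = refl
sumℕ-nth f (x ∷ xs) = cong (f x +_) (begin
  sumℕ (f ∘ nth (x ∷ xs)) (applyUpTo suc (length xs))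
    ≡⟨ cong (sumℕ (f ∘ nth (x ∷ xs))) (sym (map-applyUpTo id suc (length xs))) ⟩
  sumℕ (f ∘ nth (x ∷ xs)) (map suc (upTo (length xs)))
    ≡⟨ sumℕ-map (f ∘ nth (x ∷ xs)) suc (upTo (length xs)) ⟩
  sumℕ (f ∘ nth xs) (upTo (length xs))
    ≡⟨ sumℕ-nth f xs ⟩
  sumℕ f xs ∎)
  where open ≡-Reasoning

all-range⁺ : ∀ (P : ℕ → Bool) b a → (∀ x → b ≤ x → x ≤ a → T (P x)) → T (all P (range b a))
all-range⁺ P b a above = Allₚ.all⁻ P (Allₚ.applyUpTo⁺₁ (b +_) (suc a ∸ b)
  (λ {i} i<len → above (b + i) (ℕₚ.m≤m+n b i) (range-bound b a i i<len)))
  where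
  range-bound : ∀ b a i → i < suc a ∸ b → b + i ≤ a
  range-bound zero          a       i i<len = ℕₚ.≤-pred i<len
  range-bound (suc zero)    zero    i ()
  range-bound (suc (suc b)) zero    i ()
  range-bound (suc b)       (suc a) i i<len = s≤s (range-bound b a i i<len)

all-range⁻ : ∀ (P : ℕ → Bool) b a → T (all P (range b a)) → ∀ x → b ≤ x → x ≤ a → T (P x)
all-range⁻ P b a holds x b≤x x≤a = subst (T ∘ P) (ℕₚ.m+[n∸m]≡n b≤x)
  (Allₚ.applyUpTo⁻ (b +_) (suc a ∸ b) (Allₚ.all⁺ P (range b a) holds) (ℕₚ.∸-monoˡ-< (s≤s x≤a) b≤x))

even-suc : ∀ n → even (suc n) ≡ not (even n)
even-suc zero          = refl
even-suc (suc zero)    = refl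
even-suc (suc (suc n)) = even-suc n

even-double : ∀ k → even (k + k) ≡ true
even-double zero    = refl
even-double (suc k) = trans (cong (even ∘ suc) (ℕₚ.+-suc k k)) (even-double k)

odd⇒suc-double : ∀ x → even x ≡ false → x ≡ suc (⌊ x /2⌋ + ⌊ x /2⌋)
odd⇒suc-double (suc zero)    _   = refl
odd⇒suc-double (suc (suc x)) odd =
  cong (suc ∘ suc) (trans (odd⇒suc-double x odd) (sym (ℕₚ.+-suc ⌊ x /2⌋ ⌊ x /2⌋)))

⌊suc/2⌋ : ∀ h → ⌊ suc h /2⌋ ≡ fromBool (not (even h)) + ⌊ h /2⌋
⌊suc/2⌋ zero          = refl
⌊suc/2⌋ (suc zero)    = refl
⌊suc/2⌋ (suc (suc h)) = trans (cong suc (⌊suc/2⌋ h)) (sym (ℕₚ.+-suc _ _))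

odd-abscissa : ∀ k → 2 * suc k ∸ 1 ≡ suc (k + k)
odd-abscissa k = trans (ℕₚ.+-suc k (k + 0)) (cong (suc ∘ (k +_)) (ℕₚ.+-identityʳ k))

2*-suc : ∀ k → 2 * suc k ≡ suc (suc (k + k))
2*-suc k = cong suc (odd-abscissa k)

count-below-sameParity : ∀ M x h → h ≤ M → even x ≡ even h →
  count (λ y → even (x + y) ∧ (y <ᵇ h)) (upTo M) ≡ ⌊ h /2⌋
count-below-sameParity M x zero _ _ =
  trans (count-cong (All.universal (λ y → trans (cong (even (x + y) ∧_) (<ᵇ-zero y)) (∧-zeroʳ _)) (upTo M)))
        (count-false (upTo M))
  where
  <ᵇ-zero : ∀ y → (y <ᵇ 0) ≡ false
  <ᵇ-zero zero    = refl
  <ᵇ-zero (suc y) = refl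
count-below-sameParity (suc M) x (suc h) (s≤s h≤M) x≡h = begin
  count (λ y → even (x + y) ∧ (y <ᵇ suc h)) (upTo (suc M))
    ≡⟨ count-upTo-suc (λ y → even (x + y) ∧ (y <ᵇ suc h)) M ⟩
  fromBool (even (x + 0) ∧ true) + count (λ y → even (x + suc y) ∧ (y <ᵇ h)) (upTo M)
    ≡⟨ cong₂ _+_ (cong fromBool (trans (∧-identityʳ _) (cong even (ℕₚ.+-identityʳ x))))
                 (count-cong (All.universal (λ y → cong (λ z → even z ∧ (y <ᵇ h)) (ℕₚ.+-suc x y)) (upTo M))) ⟩
  fromBool (even x) + count (λ y → even (suc x + y) ∧ (y <ᵇ h)) (upTo M)
    ≡⟨ cong₂ _+_ (cong fromBool (trans x≡h (even-suc h))) (count-below-sameParity M (suc x) h h≤M sx≡h) ⟩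
  fromBool (not (even h)) + ⌊ h /2⌋
    ≡⟨ sym (⌊suc/2⌋ h) ⟩
  ⌊ suc h /2⌋ ∎
  where
  open ≡-Reasoning
  sx≡h : even (suc x) ≡ even h
  sx≡h = trans (even-suc x) (trans (cong not (trans x≡h (even-suc h))) (not-involutive _))

-- Heights of a path

stepAt : List DStep → ℕ → DStep
stepAt []      _       = up
stepAt (s ∷ w) zero    = s
stepAt (s ∷ w) (suc x) = stepAt w x

isDown : DStep → Bool
isDown up   = false
isDown down = true

Moves : DStep → ℕ → ℕ → Set
Moves up   a b = b ≡ suc a
Moves down a b = a ≡ suc b

Moves-parity : ∀ s {a b} → Moves s a b → even b ≡ not (even a)
Moves-parity up   {a} b≡1+a = trans (cong even b≡1+a) (even-suc a)
Moves-parity down {b = b} a≡1+b =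
  sym (trans (cong (not ∘ even) a≡1+b) (trans (cong not (even-suc b)) (not-involutive (even b))))

heights-head : ∀ h p → nth (heightsFrom h p) 0 ≡ h
heights-head h []         = refl
heights-head h (up ∷ s)   = refl
heights-head h (down ∷ s) = refl

-- Holds for every word, with the junk value 0 of nth past the end and of 0 ∸ 1.
heights-suc-≤ : ∀ h p x → nth (heightsFrom h p) (suc x) ≤ suc (nth (heightsFrom h p) x)
heights-suc-≤ h []         x       = z≤n
heights-suc-≤ h (up ∷ s)   zero    = ℕₚ.≤-reflexive (heights-head (suc h) s)
heights-suc-≤ h (up ∷ s)   (suc x) = heights-suc-≤ (suc h) s x
heights-suc-≤ h (down ∷ s) zero    =
  ℕₚ.≤-trans (ℕₚ.≤-reflexive (heights-head (h ∸ 1) s)) (ℕₚ.≤-trans (ℕₚ.m∸n≤m h 1) (ℕₚ.n≤1+n h))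
heights-suc-≤ h (down ∷ s) (suc x) = heights-suc-≤ (h ∸ 1) s x

heights-step : ∀ h p x → dyckFrom h p ≡ true → x < length p →
  Moves (stepAt p x) (nth (heightsFrom h p) x) (nth (heightsFrom h p) (suc x))
heights-step h       (up ∷ s)   zero    _     _         = heights-head (suc h) s
heights-step (suc h) (down ∷ s) zero    _     _         = cong suc (sym (heights-head h s))
heights-step h       (up ∷ s)   (suc x) dyck (s≤s x<L) = heights-step (suc h) s x dyck x<L
heights-step (suc h) (down ∷ s) (suc x) dyck (s≤s x<L) = heights-step h s x dyck x<L

length-heightsFrom : ∀ h p → length (heightsFrom h p) ≡ suc (length p)
length-heightsFrom h []         = refl
length-heightsFrom h (up ∷ s)   = cong suc (length-heightsFrom (suc h) s)
length-heightsFrom h (down ∷ s) = cong suc (length-heightsFrom (h ∸ 1) s)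

height-≤ : ∀ p x → height p x ≤ x
height-≤ p zero    = ℕₚ.≤-reflexive (heights-head 0 p)
height-≤ p (suc x) = ℕₚ.≤-trans (heights-suc-≤ 0 p x) (s≤s (height-≤ p x))

last-visit : ∀ (f : ℕ → ℕ) → (∀ x → f (suc x) ≤ suc (f x)) → ∀ {h} → f 0 ≤ h →
  ∀ y → h ≤ f y → ∃[ x₀ ] x₀ ≤ y × f x₀ ≡ h × (∀ x → x₀ ≤ x → x ≤ y → h ≤ f x)
last-visit f climb f0≤h zero h≤f0 =
  0 , z≤n , ℕₚ.≤-antisym f0≤h h≤f0 , λ x _ x≤0 → subst (λ z → _ ≤ f z) (sym (ℕₚ.n≤0⇒n≡0 x≤0)) h≤f0
last-visit f climb {h} f0≤h (suc y) h≤fy′ with f (suc y) ℕₚ.≟ h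
... | yes fy′≡h = suc y , ℕₚ.≤-refl , fy′≡h , λ x y′≤x x≤y′ →
  subst (λ z → h ≤ f z) (ℕₚ.≤-antisym y′≤x x≤y′) h≤fy′
... | no  fy′≢h =
  let x₀ , x₀≤y , fx₀≡h , above = last-visit f climb f0≤h y h≤fy in
  x₀ , ℕₚ.≤-trans x₀≤y (ℕₚ.n≤1+n y) , fx₀≡h , above′ above
  where
  h≤fy : h ≤ f y
  h≤fy = ℕₚ.≤-pred (ℕₚ.≤-trans (ℕₚ.≤∧≢⇒< h≤fy′ (fy′≢h ∘ sym)) (climb y))
  above′ : ∀ {x₀} → (∀ x → x₀ ≤ x → x ≤ y → h ≤ f x) → ∀ x → x₀ ≤ x → x ≤ suc y → h ≤ f x
  above′ above x x₀≤x x≤y′ with ℕₚ.m≤n⇒m<n∨m≡n x≤y′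
  ... | inj₁ x<y′  = above x x₀≤x (ℕₚ.≤-pred x<y′)
  ... | inj₂ refl = h≤fy′

evenDowns : List DStep → ℕ
oddDowns  : List DStep → ℕ

evenDowns []      = 0
evenDowns (s ∷ w) = fromBool (isDown s) + oddDowns w

oddDowns []      = 0
oddDowns (s ∷ w) = evenDowns w

count-downsAtEven : ∀ n p → length p ≡ n + n →
  count (λ j → isDown (stepAt p (j + j))) (upTo n) ≡ evenDowns p
count-downsAtEven zero    []           _   = refl
count-downsAtEven (suc n) (a ∷ [])     len with () ← trans (ℕₚ.suc-injective len) (ℕₚ.+-suc n n)
count-downsAtEven (suc n) (a ∷ b ∷ p) len = begin
  count (λ j → isDown (stepAt (a ∷ b ∷ p) (j + j))) (upTo (suc n))
    ≡⟨ count-upTo-suc (λ j → isDown (stepAt (a ∷ b ∷ p) (j + j))) n ⟩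
  fromBool (isDown a) + count (λ j → isDown (stepAt (b ∷ p) (j + suc j))) (upTo n)
    ≡⟨ cong (fromBool (isDown a) +_)
         (count-cong (All.universal (λ j → cong (isDown ∘ stepAt (b ∷ p)) (ℕₚ.+-suc j j)) (upTo n))) ⟩
  fromBool (isDown a) + count (λ j → isDown (stepAt p (j + j))) (upTo n)
    ≡⟨ cong (fromBool (isDown a) +_)
         (count-downsAtEven n p (ℕₚ.suc-injective (trans (ℕₚ.suc-injective len) (ℕₚ.+-suc n n)))) ⟩
  evenDowns (a ∷ b ∷ p) ∎
  where open ≡-Reasoning

module DyckPath (p : List DStep) (isDyck : dyckFrom 0 p ≡ true) where

  H : ℕ → ℕ
  H = height p

  L : ℕ
  L = length p

  H0 : H 0 ≡ 0
  H0 = heights-head 0 p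

  step : ∀ x → x < L → Moves (stepAt p x) (H x) (H (suc x))
  step x = heights-step 0 p x isDyck

  parity : ∀ x → x ≤ L → even (H x) ≡ even x
  parity zero    _   = cong even H0
  parity (suc x) x<L = trans (Moves-parity (stepAt p x) (step x x<L))
    (trans (cong not (parity x (ℕₚ.<⇒≤ x<L))) (sym (even-suc x)))

  area≡sum⌊heights/2⌋ : area p ≡ sumℕ ⌊_/2⌋ (heightsFrom 0 p)
  area≡sum⌊heights/2⌋ = begin
    area p
      ≡⟨ sumℕ-cong (Allₚ.applyUpTo⁺₁ id (suc L) column) ⟩
    sumℕ (⌊_/2⌋ ∘ H) (upTo (suc L))
      ≡⟨ cong (sumℕ (⌊_/2⌋ ∘ H) ∘ upTo) (sym (length-heightsFrom 0 p)) ⟩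
    sumℕ (⌊_/2⌋ ∘ H) (upTo (length (heightsFrom 0 p)))
      ≡⟨ sumℕ-nth ⌊_/2⌋ (heightsFrom 0 p) ⟩
    sumℕ ⌊_/2⌋ (heightsFrom 0 p) ∎
    where
    open ≡-Reasoning
    column : ∀ {x} → x < suc L → count (λ y → even (x + y) ∧ (y <ᵇ H x)) (upTo (suc L)) ≡ ⌊ H x /2⌋
    column {x} x<1+L = count-below-sameParity (suc L) x (H x) (ℕₚ.≤-trans (height-≤ p x) (ℕₚ.<⇒≤ x<1+L))
                                                (sym (parity x (ℕₚ.≤-pred x<1+L)))

  SameLevel : ℕ → ℕ → Set
  SameLevel b a = H b ≡ H a × (∀ x → b ≤ x → x ≤ a → H b ≤ H x)

  T-sameBlock : ∀ i i′ → T (sameBlock p (suc i) (suc i′)) ⇔ SameLevel (suc (i + i)) (suc (i′ + i′))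
  T-sameBlock i i′ =
    subst₂ (λ b a → T (sameBlock p (suc i) (suc i′)) ⇔ SameLevel b a) (odd-abscissa i) (odd-abscissa i′) (mk⇔ to from)
    where
    b = 2 * suc i ∸ 1
    a = 2 * suc i′ ∸ 1
    to : T (sameBlock p (suc i) (suc i′)) → SameLevel b a
    to holds with levelᵇ , aboveᵇ ← Equivalence.to T-∧ holds =
      ℕₚ.≡ᵇ⇒≡ (H b) (H a) levelᵇ , λ x b≤x x≤a → ℕₚ.≤ᵇ⇒≤ (H b) (H x) (all-range⁻ _ b a aboveᵇ x b≤x x≤a)
    from : SameLevel b a → T (sameBlock p (suc i) (suc i′))
    from (level , above) = Equivalence.from T-∧
      (ℕₚ.≡⇒≡ᵇ (H b) (H a) level , all-range⁺ _ b a (λ x b≤x x≤a → ℕₚ.≤⇒≤ᵇ (above x b≤x x≤a)))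

  up-leavesLevel : ∀ x → x < L → stepAt p x ≡ up → ∀ b → b ≤ x → ¬ SameLevel b (suc x)
  up-leavesLevel x x<L goesUp b b≤x (level , above) =
    ℕₚ.n≮n (H x) (subst (_≤ H x) (trans level climbs) (above x b≤x (ℕₚ.n≤1+n x)))
    where
    climbs : H (suc x) ≡ suc (H x)
    climbs = subst (λ s → Moves s (H x) (H (suc x))) goesUp (step x x<L)

  down-returnsToLevel : ∀ j → suc (j + j) ≤ L → stepAt p (j + j) ≡ down →
    ∃[ k ] k < j × SameLevel (suc (k + k)) (suc (j + j))
  down-returnsToLevel j a≤L goesDown =
    let x₀ , x₀≤2j , Hx₀≡Ha , above = last-visit H (heights-suc-≤ 0 p) (subst (_≤ H a) (sym H0) z≤n)
                                         (j + j) (ℕₚ.≤-trans (ℕₚ.n≤1+n (H a)) (ℕₚ.≤-reflexive (sym falls)))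
        x₀≡2k+1 = odd-visit x₀≤2j Hx₀≡Ha
    in ⌊ x₀ /2⌋ , half<j (subst (_< j + j) x₀≡2k+1 (ℕₚ.≤∧≢⇒< x₀≤2j (not-at-2j Hx₀≡Ha))) ,
       subst (λ b → SameLevel b a) x₀≡2k+1 (Hx₀≡Ha , above′ Hx₀≡Ha above)
    where
    a = suc (j + j)
    falls : H (j + j) ≡ suc (H a)
    falls = subst (λ s → Moves s (H (j + j)) (H a)) goesDown (step (j + j) a≤L)
    not-at-2j : ∀ {x₀} → H x₀ ≡ H a → x₀ ≢ j + j
    not-at-2j Hx₀≡Ha refl = ℕₚ.1+n≢n (sym (trans (sym Hx₀≡Ha) falls))
    odd-visit : ∀ {x₀} → x₀ ≤ j + j → H x₀ ≡ H a → x₀ ≡ suc (⌊ x₀ /2⌋ + ⌊ x₀ /2⌋)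
    odd-visit {x₀} x₀≤2j Hx₀≡Ha = odd⇒suc-double x₀ (begin
      even x₀                ≡⟨ sym (parity x₀ (ℕₚ.≤-trans x₀≤2j (ℕₚ.<⇒≤ a≤L))) ⟩
      even (H x₀)            ≡⟨ cong even Hx₀≡Ha ⟩
      even (H a)             ≡⟨ parity a a≤L ⟩
      even a                 ≡⟨ even-suc (j + j) ⟩
      not (even (j + j))     ≡⟨ cong not (even-double j) ⟩
      false                  ∎)
      where open ≡-Reasoning
    half<j : ∀ {k} → suc (k + k) < j + j → k < j
    half<j {k} 2k+1<2j = ℕₚ.≰⇒> (λ j≤k → ℕₚ.<⇒≱ 2k+1<2j (ℕₚ.≤-trans (ℕₚ.+-mono-≤ j≤k j≤k) (ℕₚ.n≤1+n (k + k))))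
    above′ : ∀ {x₀} → H x₀ ≡ H a → (∀ x → x₀ ≤ x → x ≤ j + j → H a ≤ H x) → ∀ x → x₀ ≤ x → x ≤ a → H x₀ ≤ H x
    above′ Hx₀≡Ha above x x₀≤x x≤a with ℕₚ.m≤n⇒m<n∨m≡n x≤a
    ... | inj₁ x<a  = subst (_≤ H x) (sym Hx₀≡Ha) (above x x₀≤x (ℕₚ.≤-pred x<a))
    ... | inj₂ refl = ℕₚ.≤-reflexive Hx₀≡Ha

  downAtEven : ℕ → Bool
  downAtEven j = isDown (stepAt p (j + j))

  blockmateBefore≡downAtEven : ∀ j → suc (j + j) ≤ L →
    any (λ i′ → sameBlock p i′ (suc j)) (range 1 j) ≡ downAtEven j
  blockmateBefore≡downAtEven j a≤L with stepAt p (j + j) in stepIs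
  ... | up   = ¬T⇒≡false λ holds →
    let k , k<j , sb = Anyₚ.applyUpTo⁻ suc (Anyₚ.any⁻ _ (range 1 j) holds) in
    up-leavesLevel (j + j) a≤L stepIs (suc (k + k)) (ℕₚ.+-mono-< k<j k<j) (Equivalence.to (T-sameBlock k j) sb)
  ... | down =
    let k , k<j , level = down-returnsToLevel j a≤L stepIs in
    Equivalence.to T-≡ (Anyₚ.any⁺ _ (Anyₚ.applyUpTo⁺ suc (Equivalence.from (T-sameBlock k j) level) k<j))

  numBlocks≡count : ∀ n → n + n ≡ L → numBlocks n p ≡ count (not ∘ downAtEven) (upTo n)
  numBlocks≡count n len = trans (count-applyUpTo-suc _ n) (count-cong (Allₚ.applyUpTo⁺₁ id n blockMinimum))
    where
    blockMinimum : ∀ {j} → j < n → not (any (λ i′ → sameBlock p i′ (suc j)) (range 1 j)) ≡ not (downAtEven j)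
    blockMinimum {j} j<n =
      cong not (blockmateBefore≡downAtEven j (ℕₚ.≤-trans (ℕₚ.+-mono-< j<n j<n) (ℕₚ.≤-reflexive len)))

  rk≡evenDowns : ∀ n → n + n ≡ L → rk n p ≡ evenDowns p
  rk≡evenDowns n len = begin
    n ∸ numBlocks n p
      ≡⟨ cong (n ∸_) (numBlocks≡count n len) ⟩
    n ∸ count (not ∘ downAtEven) (upTo n)
      ≡⟨ cong (_∸ count (not ∘ downAtEven) (upTo n))
              (sym (trans (count-not+count downAtEven (upTo n)) (length-upTo n))) ⟩
    count (not ∘ downAtEven) (upTo n) + count downAtEven (upTo n) ∸ count (not ∘ downAtEven) (upTo n)
      ≡⟨ ℕₚ.m+n∸m≡n (count (not ∘ downAtEven) (upTo n)) _ ⟩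
    count downAtEven (upTo n)
      ≡⟨ count-downsAtEven n p (sym len) ⟩
    evenDowns p ∎
    where open ≡-Reasoning

-- Motzkin paths and their images under ρ

downCount : List MStep → ℕ
downCount []       = 0
downCount (mD ∷ m) = suc (downCount m)
downCount (_  ∷ m) = downCount m

flatCount : List MStep → ℕ
flatCount []       = 0
flatCount (mH ∷ m) = suc (flatCount m)
flatCount (_  ∷ m) = flatCount m

ρtail : List MStep → List DStep
ρtail m = concatMap ρsteps m ++ down ∷ []

motzkin-length : ∀ l m → motzFrom l m ≡ true → l + length m ≡ (downCount m + downCount m) + flatCount m
motzkin-length zero    []       _     = refl
motzkin-length l       (mU ∷ m) motz  = trans (ℕₚ.+-suc l (length m)) (motzkin-length (suc l) m motz)
motzkin-length (suc l) (mD ∷ m) motz  =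
  cong suc (trans (ℕₚ.+-suc l (length m)) (trans (cong suc (motzkin-length l m motz))
                                                 (cong (_+ flatCount m) (sym (ℕₚ.+-suc (downCount m) (downCount m))))))
motzkin-length l       (mH ∷ m) motz  =
  trans (ℕₚ.+-suc l (length m)) (trans (cong suc (motzkin-length l m motz)) (sym (ℕₚ.+-suc _ (flatCount m))))

motzkin-flatCount : ∀ m → motzFrom 0 m ≡ true → length m ∸ 2 * downCount m ≡ flatCount m
motzkin-flatCount m motz = begin
  length m ∸ 2 * downCount m
    ≡⟨ cong₂ _∸_ (motzkin-length 0 m motz) (cong (downCount m +_) (ℕₚ.+-identityʳ _)) ⟩
  (downCount m + downCount m) + flatCount m ∸ (downCount m + downCount m)
    ≡⟨ ℕₚ.m+n∸m≡n (downCount m + downCount m) (flatCount m) ⟩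
  flatCount m ∎
  where open ≡-Reasoning

dyckFrom-ρtail : ∀ l m → motzFrom l m ≡ true → dyckFrom (suc (l + l)) (ρtail m) ≡ true
dyckFrom-ρtail zero    []       _    = refl
dyckFrom-ρtail l       (mU ∷ m) motz =
  subst (λ h → dyckFrom (suc h) (ρtail m) ≡ true) (ℕₚ.+-suc (suc l) l) (dyckFrom-ρtail (suc l) m motz)
dyckFrom-ρtail (suc l) (mD ∷ m) motz =
  subst (λ h → dyckFrom h (ρtail m) ≡ true) (sym (ℕₚ.+-suc l l)) (dyckFrom-ρtail l m motz)
dyckFrom-ρtail l       (mH ∷ m) motz = dyckFrom-ρtail l m motz

length-ρtail : ∀ m → length (ρtail m) ≡ suc (length m + length m)
length-ρtail []      = refl
length-ρtail (mU ∷ m) = cong (suc ∘ suc) (trans (length-ρtail m) (sym (ℕₚ.+-suc (length m) (length m))))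
length-ρtail (mD ∷ m) = cong (suc ∘ suc) (trans (length-ρtail m) (sym (ℕₚ.+-suc (length m) (length m))))
length-ρtail (mH ∷ m) = cong (suc ∘ suc) (trans (length-ρtail m) (sym (ℕₚ.+-suc (length m) (length m))))

oddDowns-ρtail : ∀ m → oddDowns (ρtail m) ≡ downCount m
oddDowns-ρtail []       = refl
oddDowns-ρtail (mU ∷ m) = oddDowns-ρtail m
oddDowns-ρtail (mD ∷ m) = cong suc (oddDowns-ρtail m)
oddDowns-ρtail (mH ∷ m) = oddDowns-ρtail m

module SemiringSums {c ℓ} (R : CommutativeSemiring c ℓ) where

  open CommutativeSemiring R renaming (Carrier to C; _+_ to _⊕_; _*_ to _⊗_)
    hiding (zero; refl; sym; trans)
  open CommutativeSemiring R using () renaming (refl to ≈-refl; sym to ≈-sym; trans to ≈-trans)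

  _^_ : C → ℕ → C
  x ^ k = pow R x k

  ^-+ : ∀ x a b → x ^ (a + b) ≈ x ^ a ⊗ x ^ b
  ^-+ x zero    b = ≈-sym (*-identityˡ _)
  ^-+ x (suc a) b = ≈-trans (*-congˡ (^-+ x a b)) (≈-sym (*-assoc _ _ _))

  sumR-++ : ∀ {A : Set} (f : A → C) xs ys → sumR R f (xs ++ ys) ≈ sumR R f xs ⊕ sumR R f ys
  sumR-++ f []       ys = ≈-sym (+-identityˡ _)
  sumR-++ f (x ∷ xs) ys = ≈-trans (+-congˡ (sumR-++ f xs ys)) (≈-sym (+-assoc _ _ _))

  sumR-map : ∀ {A B : Set} (f : B → C) (g : A → B) xs → sumR R f (map g xs) ≡ sumR R (f ∘ g) xs
  sumR-map f g []       = refl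
  sumR-map f g (x ∷ xs) = cong (f (g x) ⊕_) (sumR-map f g xs)

  sumR-cong : ∀ {A : Set} {f g : A → C} xs → (∀ x → f x ≈ g x) → sumR R f xs ≈ sumR R g xs
  sumR-cong []       f≈g = ≈-refl
  sumR-cong (x ∷ xs) f≈g = +-cong (f≈g x) (sumR-cong xs f≈g)

  sumR-*ˡ : ∀ {A : Set} (a : C) (f : A → C) xs → sumR R (λ x → a ⊗ f x) xs ≈ a ⊗ sumR R f xs
  sumR-*ˡ a f []       = ≈-sym (zeroʳ a)
  sumR-*ˡ a f (x ∷ xs) = ≈-trans (+-congˡ (sumR-*ˡ a f xs)) (≈-sym (distribˡ a _ _))

  sumR-filterᵇ-false : ∀ {A : Set} (f : A → C) xs → sumR R f (filterᵇ (λ _ → false) xs) ≡ 0#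
  sumR-filterᵇ-false f xs = cong (sumR R f) (filterᵇ-false xs)

  sumR-filterᵇ-cong : ∀ {A : Set} (P : A → Bool) {Inv : A → Set} {f g : A → C} {xs} → All Inv xs →
    (∀ x → P x ≡ true → Inv x → f x ≈ g x) → sumR R f (filterᵇ P xs) ≈ sumR R g (filterᵇ P xs)
  sumR-filterᵇ-cong P []                  f≈g = ≈-refl
  sumR-filterᵇ-cong P {xs = x ∷ xs} (i ∷ is) f≈g with P x in Px
  ... | true  = +-cong (f≈g x Px i) (sumR-filterᵇ-cong P is f≈g)
  ... | false = sumR-filterᵇ-cong P is f≈g

  sumR-filterᵇ-map : ∀ {A B : Set} (f : B → C) (P : B → Bool) (g : A → B) xs →
    sumR R f (filterᵇ P (map g xs)) ≡ sumR R (f ∘ g) (filterᵇ (P ∘ g) xs)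
  sumR-filterᵇ-map f P g xs = trans (cong (sumR R f) (filterᵇ-map P g xs)) (sumR-map f g (filterᵇ (P ∘ g) xs))

  sumR-filterᵇ-prefixes : ∀ {A : Set} (f : List A → C) (P : List A → Bool) (W : List (List A)) bs →
    sumR R f (filterᵇ P (concatMap (λ b → map (b ∷_) W) bs)) ≈
    sumR R (λ b → sumR R (f ∘ (b ∷_)) (filterᵇ (P ∘ (b ∷_)) W)) bs
  sumR-filterᵇ-prefixes f P W []       = ≈-refl
  sumR-filterᵇ-prefixes f P W (b ∷ bs) = begin
    sumR R f (filterᵇ P (map (b ∷_) W ++ rest))
      ≡⟨ cong (sumR R f) (filter-++ (T? ∘ P) (map (b ∷_) W) rest) ⟩
    sumR R f (filterᵇ P (map (b ∷_) W) ++ filterᵇ P rest)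
      ≈⟨ sumR-++ f (filterᵇ P (map (b ∷_) W)) (filterᵇ P rest) ⟩
    sumR R f (filterᵇ P (map (b ∷_) W)) ⊕ sumR R f (filterᵇ P rest)
      ≈⟨ +-cong (reflexive (sumR-filterᵇ-map f P (b ∷_) W)) (sumR-filterᵇ-prefixes f P W bs) ⟩
    sumR R (λ b → sumR R (f ∘ (b ∷_)) (filterᵇ (P ∘ (b ∷_)) W)) (b ∷ bs) ∎
    where
    open import Relation.Binary.Reasoning.Setoid setoid
    rest = concatMap (λ b → map (b ∷_) W) bs

-- Transfer-matrix sums

module DyckMotzkinSums {c ℓ} (R : CommutativeSemiring c ℓ) (q t : CommutativeSemiring.Carrier R) where

  open SemiringSums R
  open CommutativeSemiring R renaming (Carrier to C; _+_ to _⊕_; _*_ to _⊗_)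
    hiding (zero; refl; sym; trans)
  open CommutativeSemiring R using () renaming (refl to ≈-refl; sym to ≈-sym; trans to ≈-trans)
  open import Algebra.Properties.CommutativeSemigroup *-commutativeSemigroup using (x∙yz≈y∙xz)
  open import Algebra.Solver.Ring.NaturalCoefficients.Default R
  open import Relation.Binary.Reasoning.Setoid setoid

  qHalf : ℕ → C
  qHalf h = q ^ ⌊ h /2⌋

  -- Weight of a path suffix starting at height h; even/odd is the parity of its starting abscissa.
  evenWeight : ℕ → List DStep → C
  oddWeight  : ℕ → List DStep → C

  evenWeight h []         = qHalf h
  evenWeight h (up ∷ w)   = qHalf h ⊗ oddWeight (suc h) w
  evenWeight h (down ∷ w) = qHalf h ⊗ (t ⊗ oddWeight (h ∸ 1) w)

  oddWeight h []         = qHalf h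
  oddWeight h (up ∷ w)   = qHalf h ⊗ evenWeight (suc h) w
  oddWeight h (down ∷ w) = qHalf h ⊗ evenWeight (h ∸ 1) w

  qHalf-∷ : ∀ h a x → qHalf h ⊗ (q ^ a ⊗ x) ≈ q ^ (⌊ h /2⌋ + a) ⊗ x
  qHalf-∷ h a x = ≈-trans (≈-sym (*-assoc _ _ _)) (*-congʳ (≈-sym (^-+ q ⌊ h /2⌋ a)))

  qHalf-[] : ∀ h → qHalf h ≈ q ^ (⌊ h /2⌋ + 0) ⊗ 1#
  qHalf-[] h = ≈-sym (≈-trans (*-identityʳ _) (reflexive (cong (q ^_) (ℕₚ.+-identityʳ ⌊ h /2⌋))))

  evenWeight≈ : ∀ h w → evenWeight h w ≈ q ^ sumℕ ⌊_/2⌋ (heightsFrom h w) ⊗ t ^ evenDowns w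
  oddWeight≈  : ∀ h w → oddWeight h w ≈ q ^ sumℕ ⌊_/2⌋ (heightsFrom h w) ⊗ t ^ oddDowns w

  evenWeight≈ h []         = qHalf-[] h
  evenWeight≈ h (up ∷ w)   = ≈-trans (*-congˡ (oddWeight≈ (suc h) w)) (qHalf-∷ h _ _)
  evenWeight≈ h (down ∷ w) =
    ≈-trans (*-congˡ (≈-trans (*-congˡ (oddWeight≈ (h ∸ 1) w)) (x∙yz≈y∙xz t _ _))) (qHalf-∷ h _ _)

  oddWeight≈ h []         = qHalf-[] h
  oddWeight≈ h (up ∷ w)   = ≈-trans (*-congˡ (evenWeight≈ (suc h) w)) (qHalf-∷ h _ _)
  oddWeight≈ h (down ∷ w) = ≈-trans (*-congˡ (evenWeight≈ (h ∸ 1) w)) (qHalf-∷ h _ _)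

  dyckTerm≈evenWeight : ∀ n p → dyckFrom 0 p ≡ true → length p ≡ n + n →
    q ^ area p ⊗ t ^ rk n p ≈ evenWeight 0 p
  dyckTerm≈evenWeight n p isDyck len = ≈-sym (≈-trans (evenWeight≈ 0 p)
    (reflexive (cong₂ (λ a r → q ^ a ⊗ t ^ r) (sym area≡sum⌊heights/2⌋) (sym (rk≡evenDowns n (sym len))))))
    where open DyckPath p isDyck

  evenGF : ℕ → ℕ → C
  evenGF h k = sumR R (evenWeight h) (filterᵇ (dyckFrom h) (words (up ∷ down ∷ []) k))

  oddGF : ℕ → ℕ → C
  oddGF h k = sumR R (oddWeight h) (filterᵇ (dyckFrom h) (words (up ∷ down ∷ []) k))

  -- Sums over the suffixes that follow an initial down step from height h.
  evenGF↓ : ℕ → ℕ → C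
  evenGF↓ zero    k = 0#
  evenGF↓ (suc h) k = evenGF h k

  oddGF↓ : ℕ → ℕ → C
  oddGF↓ zero    k = 0#
  oddGF↓ (suc h) k = oddGF h k

  evenGF-suc : ∀ h k → evenGF h (suc k) ≈ qHalf h ⊗ oddGF (suc h) k ⊕ qHalf h ⊗ (t ⊗ oddGF↓ h k)
  evenGF-suc h k = ≈-trans (sumR-filterᵇ-prefixes (evenWeight h) (dyckFrom h) W (up ∷ down ∷ []))
    (+-cong (sumR-*ˡ (qHalf h) (oddWeight (suc h)) (filterᵇ (dyckFrom (suc h)) W))
            (≈-trans (+-identityʳ _) (downPart h)))
    where
    W = words (up ∷ down ∷ []) k
    downPart : ∀ h → sumR R (evenWeight h ∘ (down ∷_)) (filterᵇ (dyckFrom h ∘ (down ∷_)) W) ≈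
                     qHalf h ⊗ (t ⊗ oddGF↓ h k)
    downPart zero    = ≈-trans (reflexive (sumR-filterᵇ-false _ W)) (≈-sym (≈-trans (*-congˡ (zeroʳ t)) (zeroʳ _)))
    downPart (suc h) = ≈-trans (sumR-*ˡ (qHalf (suc h)) (λ w → t ⊗ oddWeight h w) (filterᵇ (dyckFrom h) W))
                                (*-congˡ (sumR-*ˡ t (oddWeight h) (filterᵇ (dyckFrom h) W)))

  oddGF-suc : ∀ h k → oddGF h (suc k) ≈ qHalf h ⊗ evenGF (suc h) k ⊕ qHalf h ⊗ evenGF↓ h k
  oddGF-suc h k = ≈-trans (sumR-filterᵇ-prefixes (oddWeight h) (dyckFrom h) W (up ∷ down ∷ []))
    (+-cong (sumR-*ˡ (qHalf h) (evenWeight (suc h)) (filterᵇ (dyckFrom (suc h)) W))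
            (≈-trans (+-identityʳ _) (downPart h)))
    where
    W = words (up ∷ down ∷ []) k
    downPart : ∀ h → sumR R (oddWeight h ∘ (down ∷_)) (filterᵇ (dyckFrom h ∘ (down ∷_)) W) ≈ qHalf h ⊗ evenGF↓ h k
    downPart zero    = ≈-trans (reflexive (sumR-filterᵇ-false _ W)) (≈-sym (zeroʳ _))
    downPart (suc h) = sumR-*ˡ (qHalf (suc h)) (evenWeight h) (filterᵇ (dyckFrom h) W)

  evenGF-ground : ∀ k → evenGF 0 (suc k) ≈ oddGF 1 k
  evenGF-ground k = ≈-trans (evenGF-suc 0 k) (solve 2 (λ x t → (con 1 :* x) :+ (con 1 :* (t :* con 0)) := x) ≈-refl _ t)

  onePlusQt : C
  onePlusQt = 1# ⊕ q ⊗ t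

  motzkinWeight : ℕ → List MStep → C
  motzkinWeight l m = oddWeight (suc (l + l)) (ρtail m) ⊗ onePlusQt ^ flatCount m

  motzkinGF : ℕ → ℕ → C
  motzkinGF l k = sumR R (motzkinWeight l) (filterᵇ (motzFrom l) (words (mU ∷ mD ∷ mH ∷ []) k))

  motzkinGF↓ : ℕ → ℕ → C
  motzkinGF↓ zero    k = 0#
  motzkinGF↓ (suc l) k = motzkinGF l k

  motzkinGF-suc : ∀ l k → motzkinGF l (suc k) ≈
    (qHalf (suc (l + l)) ⊗ qHalf (suc (suc (l + l)))) ⊗ motzkinGF (suc l) k ⊕
    ((qHalf (suc (l + l)) ⊗ qHalf (l + l)) ⊗ (t ⊗ motzkinGF↓ l k) ⊕
     (qHalf (suc (l + l)) ⊗ qHalf (l + l)) ⊗ (onePlusQt ⊗ motzkinGF l k))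
  motzkinGF-suc l k = ≈-trans (sumR-filterᵇ-prefixes (motzkinWeight l) (motzFrom l) W (mU ∷ mD ∷ mH ∷ []))
    (+-cong upPart (+-cong (downPart l) (≈-trans (+-identityʳ _) flatPart)))
    where
    W = words (mU ∷ mD ∷ mH ∷ []) k
    upWeight : ∀ w → motzkinWeight l (mU ∷ w) ≈
                     (qHalf (suc (l + l)) ⊗ qHalf (suc (suc (l + l)))) ⊗ motzkinWeight (suc l) w
    upWeight w rewrite ℕₚ.+-suc l l = solve 4 (λ a b x e → (a :* (b :* x)) :* e := (a :* b) :* (x :* e)) ≈-refl _ _ _ _
    upPart = ≈-trans (sumR-cong (filterᵇ (motzFrom (suc l)) W) upWeight)
                     (sumR-*ˡ _ (motzkinWeight (suc l)) (filterᵇ (motzFrom (suc l)) W))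
    flatWeight : ∀ w → motzkinWeight l (mH ∷ w) ≈
                       (qHalf (suc (l + l)) ⊗ qHalf (l + l)) ⊗ (onePlusQt ⊗ motzkinWeight l w)
    flatWeight w = solve 5 (λ a b x e p → (a :* (b :* x)) :* (e :* p) := (a :* b) :* (e :* (x :* p))) ≈-refl _ _ _ _ _
    flatPart = ≈-trans (sumR-cong (filterᵇ (motzFrom l) W) flatWeight)
               (≈-trans (sumR-*ˡ _ (λ w → onePlusQt ⊗ motzkinWeight l w) (filterᵇ (motzFrom l) W))
                        (*-congˡ (sumR-*ˡ onePlusQt (motzkinWeight l) (filterᵇ (motzFrom l) W))))
    downPart : ∀ l → sumR R (motzkinWeight l ∘ (mD ∷_)) (filterᵇ (motzFrom l ∘ (mD ∷_)) W) ≈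
                     (qHalf (suc (l + l)) ⊗ qHalf (l + l)) ⊗ (t ⊗ motzkinGF↓ l k)
    downPart zero    = ≈-trans (reflexive (sumR-filterᵇ-false _ W)) (≈-sym (≈-trans (*-congˡ (zeroʳ t)) (zeroʳ _)))
    downPart (suc l) = ≈-trans (sumR-cong (filterᵇ (motzFrom l) W) downWeight)
               (≈-trans (sumR-*ˡ _ (λ w → t ⊗ motzkinWeight l w) (filterᵇ (motzFrom l) W))
                        (*-congˡ (sumR-*ˡ t (motzkinWeight l) (filterᵇ (motzFrom l) W))))
      where
      downWeight : ∀ w → motzkinWeight (suc l) (mD ∷ w) ≈
                         (qHalf (suc (suc l + suc l)) ⊗ qHalf (suc l + suc l)) ⊗ (t ⊗ motzkinWeight l w)
      downWeight w rewrite ℕₚ.+-suc l l =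
        solve 5 (λ a b s x p → (a :* (b :* (s :* x))) :* p := (a :* b) :* (s :* (x :* p))) ≈-refl _ _ _ _ _

  -- Two Dyck steps from an odd height 2l + 1 against one Motzkin step from level l.
  oddGF≈motzkinGF : ∀ k l {h} → h ≡ suc (l + l) → oddGF h (suc (k + k)) ≈ motzkinGF l k
  oddGF≈motzkinGF zero zero refl = ≈-trans (oddGF-suc 1 0)
    (solve 0 ((con 1 :* con 0) :+ (con 1 :* (con 1 :+ con 0)) := ((con 1 :* con 1) :* con 1) :+ con 0) ≈-refl)
  oddGF≈motzkinGF zero (suc l) refl = ≈-trans (oddGF-suc (suc (suc l + suc l)) 0)
    (solve 1 (λ a → (a :* con 0) :+ (a :* con 0) := con 0) ≈-refl _)
  oddGF≈motzkinGF (suc k) l refl rewrite ℕₚ.+-suc k k = begin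
    oddGF h (suc (suc K))
      ≈⟨ oddGF-suc h (suc K) ⟩
    qHalf h ⊗ evenGF (suc h) (suc K) ⊕ qHalf h ⊗ evenGF (l + l) (suc K)
      ≈⟨ +-cong (*-congˡ (evenGF-suc (suc h) K)) (*-congˡ (evenGF-suc (l + l) K)) ⟩
    qHalf h ⊗ (qHalf (suc h) ⊗ oddGF (suc (suc h)) K ⊕ qHalf (suc h) ⊗ (t ⊗ oddGF h K)) ⊕
    qHalf h ⊗ (qHalf (l + l) ⊗ oddGF h K ⊕ qHalf (l + l) ⊗ (t ⊗ oddGF↓ (l + l) K))
      ≈⟨ +-cong (*-congˡ (+-cong (*-congˡ up-IH) (*-congˡ (*-congˡ level-IH))))
                (*-congˡ (+-cong (*-congˡ level-IH) (*-congˡ (*-congˡ (down-IH l))))) ⟩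
    qHalf h ⊗ (qHalf (suc h) ⊗ motzkinGF (suc l) k ⊕ qHalf (suc h) ⊗ (t ⊗ motzkinGF l k)) ⊕
    qHalf h ⊗ (qHalf (l + l) ⊗ motzkinGF l k ⊕ qHalf (l + l) ⊗ (t ⊗ motzkinGF↓ l k))
      ≈⟨ solve 7 (λ a c q t A B M → a :* ((q :* c) :* A :+ (q :* c) :* (t :* B)) :+ a :* (c :* B :+ c :* (t :* M))
                   := (a :* (q :* c)) :* A :+ ((a :* c) :* (t :* M) :+ (a :* c) :* ((con 1 :+ q :* t) :* B)))
                 ≈-refl (qHalf h) (qHalf (l + l)) q t (motzkinGF (suc l) k) (motzkinGF l k) (motzkinGF↓ l k) ⟩
    (qHalf h ⊗ qHalf (suc h)) ⊗ motzkinGF (suc l) k ⊕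
    ((qHalf h ⊗ qHalf (l + l)) ⊗ (t ⊗ motzkinGF↓ l k) ⊕ (qHalf h ⊗ qHalf (l + l)) ⊗ (onePlusQt ⊗ motzkinGF l k))
      ≈⟨ ≈-sym (motzkinGF-suc l k) ⟩
    motzkinGF l (suc k) ∎
    where
    h = suc (l + l)
    K = suc (k + k)
    up-IH : oddGF (suc (suc h)) K ≈ motzkinGF (suc l) k
    up-IH = oddGF≈motzkinGF k (suc l) (cong (suc ∘ suc) (sym (ℕₚ.+-suc l l)))
    level-IH : oddGF h K ≈ motzkinGF l k
    level-IH = oddGF≈motzkinGF k l refl
    down-IH : ∀ l → oddGF↓ (l + l) K ≈ motzkinGF↓ l k
    down-IH zero    = ≈-refl
    down-IH (suc l) = oddGF≈motzkinGF k l (ℕₚ.+-suc l l)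

  motzkinWeight≈ : ∀ k m → motzFrom 0 m ≡ true → length m ≡ k →
    motzkinWeight 0 m ≈ (q ^ areaM m ⊗ t ^ rkM (suc k) m) ⊗ onePlusQt ^ (k ∸ 2 * rkM (suc k) m)
  motzkinWeight≈ k m motz len =
    *-cong (≈-trans (≈-sym (*-identityˡ _)) (≈-sym (dyckTerm≈evenWeight (suc k) (ρ m) isDyck ρlen)))
           (reflexive (cong (onePlusQt ^_) (sym flats)))
    where
    isDyck : dyckFrom 0 (ρ m) ≡ true
    isDyck = dyckFrom-ρtail 0 m motz
    ρlen : length (ρ m) ≡ suc k + suc k
    ρlen = trans (cong suc (trans (length-ρtail m) (cong (λ n → suc (n + n)) len))) (cong suc (sym (ℕₚ.+-suc k k)))
    downs≡rk : downCount m ≡ rkM (suc k) m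
    downs≡rk = sym (trans (DyckPath.rk≡evenDowns (ρ m) isDyck (suc k) (sym ρlen)) (oddDowns-ρtail m))
    flats : k ∸ 2 * rkM (suc k) m ≡ flatCount m
    flats = trans (cong₂ (λ n d → n ∸ 2 * d) (sym len) (sym downs≡rk)) (motzkin-flatCount m motz)

mainTheorem2 : ∀ {c ℓ} (R : CommutativeSemiring c ℓ) (n : ℕ) → 1 ≤ n →
    (q t : CommutativeSemiring.Carrier R) →
    CommutativeSemiring._≈_ R
      (sumR R (λ p → CommutativeSemiring._*_ R (pow R q (area p)) (pow R t (rk n p))) (dyckPaths n))
      (sumR R (λ m → CommutativeSemiring._*_ R
                       (CommutativeSemiring._*_ R (pow R q (areaM m)) (pow R t (rkM n m)))
                       (pow R (CommutativeSemiring._+_ R (CommutativeSemiring.1# R) (CommutativeSemiring._*_ R q t))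
                              (n ∸ 1 ∸ 2 * rkM n m)))
              (motzkinPaths n))
mainTheorem2 R (suc k) _ q t = begin
  sumR R (λ p → q ^ area p ⊗ t ^ rk n p) (dyckPaths n)
    ≈⟨ sumR-filterᵇ-cong (dyckFrom 0) (words-length (up ∷ down ∷ []) (2 * n))
         (λ p isDyck len → dyckTerm≈evenWeight n p isDyck (trans len (cong (n +_) (ℕₚ.+-identityʳ n)))) ⟩
  evenGF 0 (2 * n)
    ≡⟨ cong (evenGF 0) (2*-suc k) ⟩
  evenGF 0 (suc (suc (k + k)))
    ≈⟨ evenGF-ground (suc (k + k)) ⟩
  oddGF 1 (suc (k + k))
    ≈⟨ oddGF≈motzkinGF k 0 refl ⟩
  motzkinGF 0 k
    ≈⟨ sumR-filterᵇ-cong (motzFrom 0) (words-length (mU ∷ mD ∷ mH ∷ []) k) (motzkinWeight≈ k) ⟩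
  sumR R (λ m → (q ^ areaM m ⊗ t ^ rkM n m) ⊗ onePlusQt ^ (n ∸ 1 ∸ 2 * rkM n m)) (motzkinPaths n) ∎
  where
  n = suc k
  open SemiringSums R
  open DyckMotzkinSums R q t
  open CommutativeSemiring R using (setoid) renaming (_*_ to _⊗_)
  open import Relation.Binary.Reasoning.Setoid setoid
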